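{- Let $t,u$ be $\mathrm{BCCS}(A)$ terms with $t\sqsubseteq_{\rm WIF}u$. Then for every term $t'$ with $t\Rightarrow\xrightarrow{\tau}t'$ there is a term $u'$ with $u\Rightarrow\xrightarrow{\tau}u'$ and $\mathrm{var}(u')\subseteq\mathrm{var}(t')$.
   Context: $\mathrm{BCCS}(A)$: $A$ nonempty set of visible actions, $\tau\notin A$, countably infinite variable set $V$; terms $t::=\mathbf{0}\mid\alpha t\mid t+t\mid x$, $\alpha\in A\cup\{\tau\}$; $\mathrm{var}(t)$ is the set of variables occurring in $t$. Transitions: $\alpha t\xrightarrow{\alpha}t$; if $t\xrightarrow{\alpha}t'$ then $t+u\xrightarrow{\alpha}t'$, $u+t\xrightarrow{\alpha}t'$; variables have no transitions. $\Rightarrow$: zero or more $\tau$-steps; $t\Rightarrow\xrightarrow{\tau}t'$ means $t\Rightarrow v\xrightarrow{\tau}t'$ for some $v$. A sequence $a_1\cdots a_k\in A^*$ is a trace of closed $p_0$ if $p_0\Rightarrow\xrightarrow{a_1}\Rightarrow\cdots\Rightarrow\xrightarrow{a_k}\Rightarrow p_k$; $\mathcal{T}(p)$ is the set of traces. $(a_1\cdots a_k,B)$ with $B\subseteq A^*$ is a weak impossible future of $p_0$ if there is such a path with $\mathcal{T}(p_k)\cap B=\emptyset$. $p\sqsubseteq_{\rm WIF}q$ iff (1) every weak impossible future of $p$ is one of $q$, (2) $\mathcal{T}(p)=\mathcal{T}(q)$, (3) $p\xrightarrow{\tau}$ implies $q\xrightarrow{\tau}$; for open terms, $t\sqsubseteq_{\rm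 WIF}u$ iff $\sigma(t)\sqsubseteq_{\rm WIF}\sigma(u)$ for all closed substitutions $\sigma$. -}

module Defs where

open import Data.Nat using (ℕ)
open import Data.List using (List; []; _∷_)
open import Data.Product using (Σ; ∃; _×_; _,_)
open import Data.Empty using (⊥)
open import Function.Bundles using (_⇔_)

-- The set of visible actions A is a module parameter (a type); nonemptiness
-- is imposed in the statement by requiring an element of A.
-- Variables V = ℕ (countably infinite).

module BCCS (A : Set) where

  data Act : Set where
    vis : A → Act
    τ   : Act

  data Term : Set where
    𝟎    : Term
    _∙_  : Act → Term → Term
    _⊕_  : Term → Term → Term
    var  : ℕ → Term

  infixr 7 _∙_
  infixl 6 _⊕_

  data Occurs (x : ℕ) : Term → Set where
    here : Occurs x (var x)
    pre  : ∀ {α t} → Occurs x t → Occurs x (α ∙ t)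
    sumˡ : ∀ {t u} → Occurs x t → Occurs x (t ⊕ u)
    sumʳ : ∀ {t u} → Occurs x u → Occurs x (t ⊕ u)

  _⊆var_ : Term → Term → Set
  t ⊆var u = ∀ x → Occurs x t → Occurs x u

  Closed : Term → Set
  Closed t = ∀ x → Occurs x t → ⊥

  data _—[_]→_ : Term → Act → Term → Set where
    act  : ∀ {α t} → (α ∙ t) —[ α ]→ t
    sumˡ : ∀ {t u α t'} → t —[ α ]→ t' → (t ⊕ u) —[ α ]→ t'
    sumʳ : ∀ {t u α t'} → t —[ α ]→ t' → (u ⊕ t) —[ α ]→ t'

  data _⇒_ : Term → Term → Set where
    ⇒-refl : ∀ {t} → t ⇒ t
    ⇒-step : ∀ {t t' t''} → t —[ τ ]→ t' → t' ⇒ t'' → t ⇒ t''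

  _⇒τ_ : Term → Term → Set
  t ⇒τ t' = Σ Term λ v → (t ⇒ v) × (v —[ τ ]→ t')

  data WeakPath : Term → List A → Term → Set where
    wnil  : ∀ {p p'} → p ⇒ p' → WeakPath p [] p'
    wcons : ∀ {p p₁ p₂ p₃ a s} → p ⇒ p₁ → p₁ —[ vis a ]→ p₂ →
            WeakPath p₂ s p₃ → WeakPath p (a ∷ s) p₃

  Trace : Term → List A → Set
  Trace p s = Σ Term λ p' → WeakPath p s p'

  WeakImpFut : Term → List A → (List A → Set) → Set
  WeakImpFut p s B =
    Σ Term λ p' → WeakPath p s p' × (∀ w → Trace p' w → B w → ⊥)

  _⊑WIFc_ : Term → Term → Set₁
  p ⊑WIFc q =
    (∀ s (B : List A → Set) → WeakImpFut p s B → WeakImpFut q s B)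
    × (∀ s → Trace p s ⇔ Trace q s)
    × ((∃ λ p' → p —[ τ ]→ p') → ∃ λ q' → q —[ τ ]→ q')

  _[_] : Term → (ℕ → Term) → Term
  𝟎 [ σ ] = 𝟎
  (α ∙ t) [ σ ] = α ∙ (t [ σ ])
  (t ⊕ u) [ σ ] = (t [ σ ]) ⊕ (u [ σ ])
  var x [ σ ] = σ x

  ClosedSubst : (ℕ → Term) → Set
  ClosedSubst σ = ∀ x → Closed (σ x)

  _⊑WIF_ : Term → Term → Set₁
  t ⊑WIF u = ∀ (σ : ℕ → Term) → ClosedSubst σ → (t [ σ ]) ⊑WIFc (u [ σ ])

-- Substitute 𝟎 for the variables of t′ and the chain a ⋯ a 𝟎 of length
-- n = 1 + height t′ for every other variable. Then t′[σ] has only traces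
-- shorter than n, so ([] , {w | n ≤ |w|}) is a weak impossible future of t[σ],
-- hence of u[σ]: some u[σ] ⇒ q has no trace of length ≥ n. As σ introduces no
-- τ-steps, q = u′[σ] with u′ = u or u ⇒τ u′, and a variable of u′ outside
-- var(t′) would contribute a trace of length ≥ n. If u′ = u, the τ-clause of
-- ⊑WIF gives a step u —τ→ u₁, and var(u₁) ⊆ var(u) ⊆ var(t′).
module Submission where

open import Defs
open import Data.Product using (Σ; _×_; _,_; proj₁; proj₂)
open import Data.Sum using (_⊎_; inj₁; inj₂)
open import Data.Nat using (ℕ; zero; suc; _+_; _≤_; _<_; _⊔_; z≤n; s≤s)
open import Data.Nat.Properties
open import Data.List using (List; []; _∷_; length; replicate; _++_)
open import Data.List.Properties using (length-++; length-replicate)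
open import Data.Empty using (⊥-elim)
open import Relation.Nullary using (Dec; yes; no; ¬_)
open import Relation.Binary.PropositionalEquality using (_≡_; refl; sym; subst)

module _ {A : Set} where
  open BCCS A

  occurs? : (x : ℕ) (t : Term) → Dec (Occurs x t)
  occurs? x 𝟎 = no λ ()
  occurs? x (α ∙ t) with occurs? x t
  ... | yes o = yes (pre o)
  ... | no ¬o = no λ { (pre o) → ¬o o }
  occurs? x (t ⊕ u) with occurs? x t | occurs? x u
  ... | yes o | _     = yes (sumˡ o)
  ... | no _  | yes o = yes (sumʳ o)
  ... | no ¬o | no ¬o′ = no λ { (sumˡ o) → ¬o o ; (sumʳ o) → ¬o′ o }
  occurs? x (var y) with x ≟ y
  ... | yes refl = yes here
  ... | no x≢y   = no λ { here → x≢y refl }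

  —→-⊆var : ∀ {t α t′} → t —[ α ]→ t′ → t′ ⊆var t
  —→-⊆var act      x o = pre o
  —→-⊆var (sumˡ s) x o = sumˡ (—→-⊆var s x o)
  —→-⊆var (sumʳ s) x o = sumʳ (—→-⊆var s x o)

  ⇒τ-⇒ : ∀ {t t′} → t ⇒τ t′ → t ⇒ t′
  ⇒τ-⇒ (_ , ⇒-refl     , s) = ⇒-step s ⇒-refl
  ⇒τ-⇒ (v , ⇒-step s r , s′) = ⇒-step s (⇒τ-⇒ (v , r , s′))

  ⇒τ-first : ∀ {t t′} → t ⇒τ t′ → Σ Term λ t₁ → t —[ τ ]→ t₁
  ⇒τ-first (_ , ⇒-refl     , s) = _ , s
  ⇒τ-first (_ , ⇒-step s _ , _) = _ , s

  height : Term → ℕ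
  height 𝟎       = 0
  height (α ∙ t) = suc (height t)
  height (t ⊕ u) = height t ⊔ height u
  height (var x) = 0

  —→-height< : ∀ {t α t′} → t —[ α ]→ t′ → height t′ < height t
  —→-height< act              = ≤-refl
  —→-height< (sumˡ {t} {u} s) = <-≤-trans (—→-height< s) (m≤m⊔n (height t) (height u))
  —→-height< (sumʳ {t} {u} s) = <-≤-trans (—→-height< s) (m≤n⊔m (height u) (height t))

  ⇒-height≤ : ∀ {t t′} → t ⇒ t′ → height t′ ≤ height t
  ⇒-height≤ ⇒-refl       = ≤-refl
  ⇒-height≤ (⇒-step s r) = ≤-trans (⇒-height≤ r) (<⇒≤ (—→-height< s))

  WeakPath-length≤height : ∀ {t w t′} → WeakPath t w t′ → length w ≤ height t
  WeakPath-length≤height (wnil _) = z≤n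
  WeakPath-length≤height (wcons r s p) =
    ≤-trans (<-≤-trans (s≤s (WeakPath-length≤height p)) (—→-height< s)) (⇒-height≤ r)

  Trace-length≤height : ∀ {t w} → Trace t w → length w ≤ height t
  Trace-length≤height (_ , p) = WeakPath-length≤height p

  []-height≤ : ∀ (σ : ℕ → Term) t → (∀ x → Occurs x t → height (σ x) ≡ 0) →
               height (t [ σ ]) ≤ height t
  []-height≤ σ 𝟎       h = z≤n
  []-height≤ σ (α ∙ t) h = s≤s ([]-height≤ σ t λ x o → h x (pre o))
  []-height≤ σ (t ⊕ u) h =
    ⊔-mono-≤ ([]-height≤ σ t λ x o → h x (sumˡ o)) ([]-height≤ σ u λ x o → h x (sumʳ o))
  []-height≤ σ (var x) h rewrite h x here = z≤n

  —→-[] : ∀ (σ : ℕ → Term) {t α t′} → t —[ α ]→ t′ → (t [ σ ]) —[ α ]→ (t′ [ σ ])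
  —→-[] σ act      = act
  —→-[] σ (sumˡ s) = sumˡ (—→-[] σ s)
  —→-[] σ (sumʳ s) = sumʳ (—→-[] σ s)

  ⇒-[] : ∀ (σ : ℕ → Term) {t t′} → t ⇒ t′ → (t [ σ ]) ⇒ (t′ [ σ ])
  ⇒-[] σ ⇒-refl       = ⇒-refl
  ⇒-[] σ (⇒-step s r) = ⇒-step (—→-[] σ s) (⇒-[] σ r)

  τ-Free : Term → Set
  τ-Free p = ∀ q → ¬ (p —[ τ ]→ q)

  module _ (σ : ℕ → Term) (σ-τ-free : ∀ x → τ-Free (σ x)) where

    []-—τ→-reflect : ∀ t {q} → (t [ σ ]) —[ τ ]→ q →
                     Σ Term λ t′ → (t —[ τ ]→ t′) × (q ≡ t′ [ σ ])
    []-—τ→-reflect (α ∙ t) act = t , act , refl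
    []-—τ→-reflect (t ⊕ u) (sumˡ s) with []-—τ→-reflect t s
    ... | t′ , s′ , eq = t′ , sumˡ s′ , eq
    []-—τ→-reflect (t ⊕ u) (sumʳ s) with []-—τ→-reflect u s
    ... | u′ , s′ , eq = u′ , sumʳ s′ , eq
    []-—τ→-reflect (var x) s = ⊥-elim (σ-τ-free x _ s)

    []-⇒-reflect : ∀ t {q} → (t [ σ ]) ⇒ q →
                   (q ≡ t [ σ ]) ⊎ (Σ Term λ t′ → (t ⇒τ t′) × (q ≡ t′ [ σ ]))
    []-⇒-reflect t ⇒-refl = inj₁ refl
    []-⇒-reflect t (⇒-step s r) with []-—τ→-reflect t s
    ... | t₁ , s′ , refl with []-⇒-reflect t₁ r
    ... | inj₁ refl = inj₂ (t₁ , (t , ⇒-refl , s′) , refl)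
    ... | inj₂ (t′ , (v , r′ , s″) , eq) = inj₂ (t′ , (v , ⇒-step s′ r′ , s″) , eq)

  Trace-⊕ˡ : ∀ {t u w} → Trace t w → Trace (t ⊕ u) w
  Trace-⊕ˡ {t} {u} {[]} _                 = t ⊕ u , wnil ⇒-refl
  Trace-⊕ˡ (p , wcons ⇒-refl s q)       = p , wcons ⇒-refl (sumˡ s) q
  Trace-⊕ˡ (p , wcons (⇒-step s′ r) s q) = p , wcons (⇒-step (sumˡ s′) r) s q

  Trace-⊕ʳ : ∀ {t u w} → Trace u w → Trace (t ⊕ u) w
  Trace-⊕ʳ {t} {u} {[]} _                 = t ⊕ u , wnil ⇒-refl
  Trace-⊕ʳ (p , wcons ⇒-refl s q)       = p , wcons ⇒-refl (sumʳ s) q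
  Trace-⊕ʳ (p , wcons (⇒-step s′ r) s q) = p , wcons (⇒-step (sumʳ s′) r) s q

  Trace-τ∙ : ∀ {t w} → Trace t w → Trace (τ ∙ t) w
  Trace-τ∙ {t} {[]} _           = τ ∙ t , wnil ⇒-refl
  Trace-τ∙ (p , wcons r s q) = p , wcons (⇒-step act r) s q

  Trace-vis∙ : ∀ {t w} a → Trace t w → Trace (vis a ∙ t) (a ∷ w)
  Trace-vis∙ a (p , q) = p , wcons ⇒-refl act q

  Occurs-Trace-[] : ∀ (σ : ℕ → Term) {x t w} → Occurs x t → Trace (σ x) w →
                    Σ (List A) λ s → Trace (t [ σ ]) (s ++ w)
  Occurs-Trace-[] σ here tr = [] , tr
  Occurs-Trace-[] σ (pre {τ} o) tr with Occurs-Trace-[] σ o tr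
  ... | s , tr′ = s , Trace-τ∙ tr′
  Occurs-Trace-[] σ (pre {vis a} o) tr with Occurs-Trace-[] σ o tr
  ... | s , tr′ = a ∷ s , Trace-vis∙ a tr′
  Occurs-Trace-[] σ (sumˡ o) tr with Occurs-Trace-[] σ o tr
  ... | s , tr′ = s , Trace-⊕ˡ tr′
  Occurs-Trace-[] σ (sumʳ o) tr with Occurs-Trace-[] σ o tr
  ... | s , tr′ = s , Trace-⊕ʳ tr′

  chain : A → ℕ → Term
  chain a zero    = 𝟎
  chain a (suc n) = vis a ∙ chain a n

  chain-Trace : ∀ a n → Trace (chain a n) (replicate n a)
  chain-Trace a zero    = 𝟎 , wnil ⇒-refl
  chain-Trace a (suc n) = Trace-vis∙ a (chain-Trace a n)

  chain-closed : ∀ a n → Closed (chain a n)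
  chain-closed a (suc n) x (pre o) = chain-closed a n x o

  chain-τ-free : ∀ a n → τ-Free (chain a n)
  chain-τ-free a zero    _ ()
  chain-τ-free a (suc n) _ ()

  zeroOn : Term → Term → ℕ → Term
  zeroOn t p x with occurs? x t
  ... | yes _ = 𝟎
  ... | no _  = p

  zeroOn-closed : ∀ t {p} → Closed p → ClosedSubst (zeroOn t p)
  zeroOn-closed t cl x with occurs? x t
  ... | yes _ = λ _ ()
  ... | no _  = cl

  zeroOn-τ-free : ∀ t {p} → τ-Free p → ∀ x → τ-Free (zeroOn t p x)
  zeroOn-τ-free t free x with occurs? x t
  ... | yes _ = λ _ ()
  ... | no _  = free

  zeroOn-height : ∀ t p x → Occurs x t → height (zeroOn t p x) ≡ 0
  zeroOn-height t p x o with occurs? x t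
  ... | yes _ = refl
  ... | no ¬o = ⊥-elim (¬o o)

  zeroOn-outside : ∀ t p x → ¬ Occurs x t → zeroOn t p x ≡ p
  zeroOn-outside t p x ¬o with occurs? x t
  ... | yes o = ⊥-elim (¬o o)
  ... | no _  = refl

  Longer : ℕ → List A → Set
  Longer n w = n ≤ length w

  zeroOn-Trace-length : ∀ t p {w} → Trace (t [ zeroOn t p ]) w → length w ≤ height t
  zeroOn-Trace-length t p tr =
    ≤-trans (Trace-length≤height tr) ([]-height≤ (zeroOn t p) t (zeroOn-height t p))

  Longer-++-replicate : ∀ (s : List A) n a → Longer n (s ++ replicate n a)
  Longer-++-replicate s n a = begin
    n                                 ≡⟨ length-replicate n ⟨
    length (replicate n a)            ≤⟨ m≤n+m _ (length s) ⟩
    length s + length (replicate n a) ≡⟨ length-++ s ⟨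
    length (s ++ replicate n a)       ∎
    where open ≤-Reasoning

  no-Longer-Trace⇒⊆var : ∀ t u a n →
    (∀ w → Trace (u [ zeroOn t (chain a n) ]) w → ¬ Longer n w) → u ⊆var t
  no-Longer-Trace⇒⊆var t u a n noLonger x o with occurs? x t
  ... | yes o′ = o′
  ... | no ¬o′ with Occurs-Trace-[] σ o σx-Trace
    where
    σ = zeroOn t (chain a n)
    σx-Trace : Trace (σ x) (replicate n a)
    σx-Trace = subst (λ p → Trace p (replicate n a))
                     (sym (zeroOn-outside t (chain a n) x ¬o′)) (chain-Trace a n)
  ... | s , tr = ⊥-elim (noLonger _ tr (Longer-++-replicate s n a))

lemma6 : {A : Set} → A → (t u : BCCS.Term A) → BCCS._⊑WIF_ A t u →
    (t' : BCCS.Term A) → BCCS._⇒τ_ A t t' →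
    Σ (BCCS.Term A) λ u' → BCCS._⇒τ_ A u u' × BCCS._⊆var_ A u' t'
lemma6 {A} a t u t⊑u t′ t⇒τt′ = from-future (proj₁ ⊑c [] (Longer n) t[σ]-future)
  where
  open BCCS A
  n = suc (height t′)
  σ = zeroOn t′ (chain a n)
  σ-τ-free = zeroOn-τ-free t′ (chain-τ-free a n)
  ⊑c = t⊑u σ (zeroOn-closed t′ (chain-closed a n))

  Goal : Set
  Goal = Σ Term λ u′ → (u ⇒τ u′) × (u′ ⊆var t′)

  t[σ]-future : WeakImpFut (t [ σ ]) [] (Longer n)
  t[σ]-future = t′ [ σ ] , wnil (⇒-[] σ (⇒τ-⇒ t⇒τt′)) ,
                λ w tr → <⇒≱ (s≤s (zeroOn-Trace-length t′ (chain a n) tr))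

  u[σ]-τ : Σ Term λ q → (u [ σ ]) —[ τ ]→ q
  u[σ]-τ = proj₂ (proj₂ ⊑c) (_ , —→-[] σ (proj₂ (⇒τ-first t⇒τt′)))

  conclude : ∀ {q} → (∀ w → Trace q w → ¬ Longer n w) →
             (q ≡ u [ σ ]) ⊎ (Σ Term λ u′ → (u ⇒τ u′) × (q ≡ u′ [ σ ])) → Goal
  conclude noLonger (inj₂ (u′ , u⇒τu′ , refl)) =
    u′ , u⇒τu′ , no-Longer-Trace⇒⊆var t′ u′ a n noLonger
  conclude noLonger (inj₁ refl) with []-—τ→-reflect σ σ-τ-free u (proj₂ u[σ]-τ)
  ... | u₁ , u—τ→u₁ , _ =
    u₁ , (u , ⇒-refl , u—τ→u₁) ,
    λ x o → no-Longer-Trace⇒⊆var t′ u a n noLonger x (—→-⊆var u—τ→u₁ x o)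

  from-future : WeakImpFut (u [ σ ]) [] (Longer n) → Goal
  from-future (q , wnil u[σ]⇒q , noLonger) = conclude noLonger ([]-⇒-reflect σ σ-τ-free u u[σ]⇒q)
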